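{- Let $D$ be a diagram with $|G(D)|=0$. Then the ghost Kohnert poset $\mathcal{P}_G(D)$ is a lattice if and only if it is bounded.
   Context: A diagram is a finite set of cells placed at positions $(r,c)\in\mathbb{Z}_{>0}\times\mathbb{Z}_{>0}$ ($r$ the row, counted from the bottom; $c$ the column), each position holding at most one cell; each cell is either an ordinary cell, written $(r,c)$, or a ghost cell, written $\langle r,c\rangle$. A position is empty if it holds no cell of either kind. $G(D)$ denotes the set of ghost cells of $D$. The ghost move at row $r$ of $D$, with result denoted $\mathcal{G}(D,r)$, is defined as follows: if row $r$ is empty, $\mathcal{G}(D,r)=D$. Otherwise let $c$ be the largest column of a cell in row $r$. If this rightmost cell is a ghost cell, or there is no empty position $(\hat r,c)$ with $\hat r<r$, or, letting $\hat r<r$ be maximal with $(\hat r,c)$ empty, there is a ghost cell $\langle r^*,c\rangle$ with $\hat r<r^*<r$, then $\mathcal{G}(D,r)=D$. Otherwise, with $\hat r<r$ maximal such that $(\hat r,c)$ is empty, $\mathcal{G}(D,r)=(D\setminus\{(r,c)\})\cup\{(\hat r,c),\langle r,c\rangle\}$. $\mathrm{GKD}(D)$ is the set of all diagrams obtainable from $D$ by finite (possibly empty) sequences of ghost moves. The ghost Kohnert poset $\mathcal{P}_G(D)$ has underlying set $\mathrm{GKD}(D)$, with $D_2\preceq D_1$ iff $D_2$ can be obtained from $D_1$ by a finite (possibly empty) sequence of ghost moves. A poset is bounded if it has a unique minimal element and a unique maximal element. -}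

module Defs where

open import Data.Nat using (ℕ; _≤_; _<_)
open import Data.Product using (Σ; ∃; ∃-syntax; _×_; _,_)
open import Data.Sum using (_⊎_)
open import Relation.Binary.PropositionalEquality using (_≡_; _≢_)
open import Relation.Nullary using (¬_)

data Cell : Set where
  empty ordinary ghost : Cell

-- CONVENTION: index (i , j) ∈ ℕ × ℕ stands for the position (i+1 , j+1)
-- of the paper (row counted from the bottom, then column); this shift
-- preserves the order of rows and columns.
record Diagram : Set where
  field
    cell   : ℕ → ℕ → Cell
    bound  : ℕ
    finite : ∀ r c → bound ≤ r ⊎ bound ≤ c → cell r c ≡ empty
open Diagram public

_≈_ : Diagram → Diagram → Set
D ≈ E = ∀ r c → cell D r c ≡ cell E r c

NoGhosts : Diagram → Set
NoGhosts D = ∀ r c → cell D r c ≢ ghost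

Applicable : Diagram → (r c r̂ : ℕ) → Set
Applicable D r c r̂ =
  (cell D r c ≡ ordinary)
  × (∀ c' → c < c' → cell D r c' ≡ empty)
  × (r̂ < r)
  × (cell D r̂ c ≡ empty)
  × (∀ r' → r̂ < r' → r' < r → cell D r' c ≢ empty)
  × (∀ r* → r̂ < r* → r* < r → cell D r* c ≢ ghost)

MoveResult : Diagram → (r c r̂ : ℕ) → Diagram → Set
MoveResult D r c r̂ E =
  (cell E r c ≡ ghost)
  × (cell E r̂ c ≡ ordinary)
  × (∀ p q → ¬ (p ≡ r × q ≡ c) → ¬ (p ≡ r̂ × q ≡ c) → cell E p q ≡ cell D p q)

GhostMove : Diagram → ℕ → Diagram → Set
GhostMove D r E =
  (Σ ℕ λ c → Σ ℕ λ r̂ → Applicable D r c r̂ × MoveResult D r c r̂ E)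
  ⊎ ((∀ c r̂ → ¬ Applicable D r c r̂) × E ≈ D)

data _⇝*_ : Diagram → Diagram → Set where
  done : ∀ {D E} → E ≈ D → D ⇝* E
  step : ∀ {D D' E} r → GhostMove D r D' → D' ⇝* E → D ⇝* E

GKD : Diagram → Set
GKD D = Σ Diagram λ E → D ⇝* E

module GhostKohnertPoset (D : Diagram) where
  _≼_ : GKD D → GKD D → Set
  (x , _) ≼ (y , _) = y ⇝* x

  _≐_ : GKD D → GKD D → Set
  (x , _) ≐ (y , _) = x ≈ y

  IsJoin : GKD D → GKD D → GKD D → Set
  IsJoin x y z = x ≼ z × y ≼ z × (∀ w → x ≼ w → y ≼ w → z ≼ w)

  IsMeet : GKD D → GKD D → GKD D → Set
  IsMeet x y z = z ≼ x × z ≼ y × (∀ w → w ≼ x → w ≼ y → w ≼ z)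

  IsLattice : Set
  IsLattice = ∀ x y → (∃[ z ] IsJoin x y z) × (∃[ z ] IsMeet x y z)

  Minimal : GKD D → Set
  Minimal m = ∀ x → x ≼ m → x ≐ m

  Maximal : GKD D → Set
  Maximal m = ∀ x → m ≼ x → x ≐ m

  IsBounded : Set
  IsBounded =
    (∃[ m ] (Minimal m × (∀ m' → Minimal m' → m' ≐ m)))
    × (∃[ M ] (Maximal M × (∀ M' → Maximal M' → M' ≐ M)))

{-# OPTIONS --safe #-}
-- Ghosts never disappear, and a move leaves exactly one new ghost, at its source. Hence D,
-- having no ghosts, is the unique maximal element, while saturating by moves yields minimal
-- elements, so boundedness amounts to a unique minimal element m₀. Given m₀, two moves of a
-- reachable diagram in different rows commute: in the only two configurations where they do
-- not (the upper move jumps over the source of the lower one in its column, or lands in its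
-- row to the right of it), one branch freezes a cell as ordinary while the other turns it into
-- a ghost, yet both branches reach m₀. With commuting moves, one reachable diagram lies below
-- another exactly when it has more ghosts; the meet of X and Y is reached by replaying the
-- moves of one after the other, and their join saturates D by the moves whose ghosts X and Y
-- share. Conversely, in a lattice the meet of two minimal elements lies below both, so they
-- coincide.
module Submission where

open import Defs
open import Data.Empty using (⊥-elim)
open import Data.Nat using (ℕ; zero; suc; _+_; _≤_; _<_; z≤n; s≤s; _≟_; _<?_)
open import Data.Nat.Properties
open import Data.Nat.Induction using (<-wellFounded)
open import Data.Product using (Σ; ∃; ∃-syntax; _×_; _,_; proj₁; proj₂; map₂; swap)
open import Data.Sum using (_⊎_; inj₁; inj₂; [_,_])
open import Function.Base using (_∘_)
open import Function.Bundles using (_⇔_; mk⇔)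
open import Induction.WellFounded using (Acc; acc)
open import Level using (0ℓ; lift)
open import Relation.Binary.Core using (Rel; _⇒_)
open import Relation.Binary.Definitions using (Decidable; DecidableEquality; tri<; tri≈; tri>)
open import Relation.Binary.Construct.Always using (Always)
open import Relation.Binary.Construct.Never using (Never)
open import Relation.Binary.Construct.Intersection using (_∩_; decidable)
open import Relation.Binary.Construct.Union using (_∪_)
open import Relation.Binary.PropositionalEquality using (_≡_; _≢_; refl; sym; trans; subst)
open import Relation.Nullary using (¬_; Dec; yes; no)
open import Relation.Nullary.Decidable using (_×-dec_; _→-dec_; ¬?; map′)

_≟ᶜ_ : DecidableEquality Cell
empty    ≟ᶜ empty    = yes refl
empty    ≟ᶜ ordinary = no λ ()
empty    ≟ᶜ ghost    = no λ ()
ordinary ≟ᶜ empty    = no λ ()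
ordinary ≟ᶜ ordinary = yes refl
ordinary ≟ᶜ ghost    = no λ ()
ghost    ≟ᶜ empty    = no λ ()
ghost    ≟ᶜ ordinary = no λ ()
ghost    ≟ᶜ ghost    = yes refl

ordinary⇒nonempty : ∀ {a} → a ≡ ordinary → a ≢ empty
ordinary⇒nonempty refl ()

ghost⇒nonempty : ∀ {a} → a ≡ ghost → a ≢ empty
ghost⇒nonempty refl ()

ordinary⇒not-ghost : ∀ {a} → a ≡ ordinary → a ≢ ghost
ordinary⇒not-ghost refl ()

-- _≈_ unfolds to a Π-type from which Agda cannot infer the two diagrams;
-- the record wrapper restores that inference.
record _≅_ (D E : Diagram) : Set where
  constructor mk≅
  field pointwise : D ≈ E
open _≅_ public

≅-refl : ∀ {D} → D ≅ D
≅-refl = mk≅ λ _ _ → refl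

≅-sym : ∀ {D E} → D ≅ E → E ≅ D
≅-sym (mk≅ e) = mk≅ λ p q → sym (e p q)

≅-trans : ∀ {D E F} → D ≅ E → E ≅ F → D ≅ F
≅-trans (mk≅ e) (mk≅ f) = mk≅ λ p q → trans (e p q) (f p q)

record Move (D : Diagram) (r c r̂ : ℕ) (E : Diagram) : Set where
  constructor mkMove
  field
    applicable : Applicable D r c r̂
    result     : MoveResult D r c r̂ E

  source-ordinary : cell D r c ≡ ordinary
  source-ordinary = proj₁ applicable

  right-of-source-empty : ∀ c' → c < c' → cell D r c' ≡ empty
  right-of-source-empty = proj₁ (proj₂ applicable)

  target<source : r̂ < r
  target<source = proj₁ (proj₂ (proj₂ applicable))

  target-empty : cell D r̂ c ≡ empty
  target-empty = proj₁ (proj₂ (proj₂ (proj₂ applicable)))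

  between-nonempty : ∀ r' → r̂ < r' → r' < r → cell D r' c ≢ empty
  between-nonempty = proj₁ (proj₂ (proj₂ (proj₂ (proj₂ applicable))))

  between-not-ghost : ∀ r' → r̂ < r' → r' < r → cell D r' c ≢ ghost
  between-not-ghost = proj₂ (proj₂ (proj₂ (proj₂ (proj₂ applicable))))

  source-ghost : cell E r c ≡ ghost
  source-ghost = proj₁ result

  target-ordinary : cell E r̂ c ≡ ordinary
  target-ordinary = proj₁ (proj₂ result)

  unchanged : ∀ {p q} → ¬ (p ≡ r × q ≡ c) → ¬ (p ≡ r̂ × q ≡ c) → cell E p q ≡ cell D p q
  unchanged {p} {q} = proj₂ (proj₂ result) p q
open Move public

data Site (r c r̂ p q : ℕ) : Set where
  at-source : p ≡ r → q ≡ c → Site r c r̂ p q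
  at-target : p ≡ r̂ → q ≡ c → Site r c r̂ p q
  elsewhere : ¬ (p ≡ r × q ≡ c) → ¬ (p ≡ r̂ × q ≡ c) → Site r c r̂ p q

site : ∀ r c r̂ p q → Site r c r̂ p q
site r c r̂ p q with p ≟ r | p ≟ r̂ | q ≟ c
... | _        | _        | no q≢c  = elsewhere (q≢c ∘ proj₂) (q≢c ∘ proj₂)
... | yes p≡r  | _        | yes q≡c = at-source p≡r q≡c
... | no _     | yes p≡r̂  | yes q≡c = at-target p≡r̂ q≡c
... | no p≢r   | no p≢r̂   | yes _   = elsewhere (p≢r ∘ proj₁) (p≢r̂ ∘ proj₁)

Applicable-resp-≅ : ∀ {D D' r c r̂} → D ≅ D' → Applicable D r c r̂ → Applicable D' r c r̂
Applicable-resp-≅ {r = r} {c} {r̂} (mk≅ e) (ord , right , r̂<r , emp , filled , noGhost) =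
  trans (sym (e r c)) ord , (λ c' c<c' → trans (sym (e r c')) (right c' c<c')) , r̂<r ,
  trans (sym (e r̂ c)) emp , (λ r' l u → filled r' l u ∘ trans (e r' c)) ,
  (λ r' l u → noGhost r' l u ∘ trans (e r' c))

MoveResult-resp-≅ : ∀ {D D' E r c r̂} → D ≅ D' → MoveResult D r c r̂ E → MoveResult D' r c r̂ E
MoveResult-resp-≅ (mk≅ e) (gh , ord , rest) = gh , ord , λ p q ≠src ≠tgt → trans (rest p q ≠src ≠tgt) (e p q)

Move-resp-≅ : ∀ {D D' E r c r̂} → D ≅ D' → Move D r c r̂ E → Move D' r c r̂ E
Move-resp-≅ {E = E} e (mkMove a m) = mkMove (Applicable-resp-≅ e a) (MoveResult-resp-≅ {E = E} e m)

ghost-persists-move : ∀ {D r c r̂ E p q} → Move D r c r̂ E → cell D p q ≡ ghost → cell E p q ≡ ghost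
ghost-persists-move {r = r} {c} {r̂} {p = p} {q} m g with site r c r̂ p q
... | at-source refl refl = source-ghost m
... | at-target refl refl = ⊥-elim (ghost⇒nonempty g (target-empty m))
... | elsewhere ≠src ≠tgt = trans (unchanged m ≠src ≠tgt) g

nonempty-persists-move : ∀ {D r c r̂ E p q} → Move D r c r̂ E → cell D p q ≢ empty → cell E p q ≢ empty
nonempty-persists-move {r = r} {c} {r̂} {p = p} {q} m ne with site r c r̂ p q
... | at-source refl refl = ghost⇒nonempty (source-ghost m)
... | at-target refl refl = ordinary⇒nonempty (target-ordinary m)
... | elsewhere ≠src ≠tgt = ne ∘ trans (sym (unchanged m ≠src ≠tgt))

ordinary-persists-move : ∀ {D r c r̂ E p q} → Move D r c r̂ E → cell D p q ≡ ordinary → ¬ (p ≡ r × q ≡ c) →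
                         cell E p q ≡ ordinary
ordinary-persists-move {r = r} {c} {r̂} {p = p} {q} m ord ≠src with site r c r̂ p q
... | at-source p≡r q≡c   = ⊥-elim (≠src (p≡r , q≡c))
... | at-target refl refl = ⊥-elim (ordinary⇒nonempty ord (target-empty m))
... | elsewhere ≠src ≠tgt = trans (unchanged m ≠src ≠tgt) ord

new-ghost-at-source : ∀ {D r c r̂ E p q} → Move D r c r̂ E → cell E p q ≡ ghost →
                      cell D p q ≡ ghost ⊎ (p ≡ r × q ≡ c)
new-ghost-at-source {r = r} {c} {r̂} {p = p} {q} m g with site r c r̂ p q
... | at-source p≡r q≡c   = inj₂ (p≡r , q≡c)
... | at-target refl refl = ⊥-elim (ordinary⇒not-ghost (target-ordinary m) g)
... | elsewhere ≠src ≠tgt = inj₁ (trans (sym (unchanged m ≠src ≠tgt)) g)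

move-position-unique : ∀ {D r c r̂ E c' r̂' E'} → Move D r c r̂ E → Move D r c' r̂' E' → c ≡ c' × r̂ ≡ r̂'
move-position-unique {c = c} {r̂} {c' = c'} {r̂'} m m' with <-cmp c c'
... | tri< c<c' _ _ = ⊥-elim (ordinary⇒nonempty (source-ordinary m') (right-of-source-empty m c' c<c'))
... | tri> _ _ c'<c = ⊥-elim (ordinary⇒nonempty (source-ordinary m) (right-of-source-empty m' c c'<c))
... | tri≈ _ refl _ with <-cmp r̂ r̂'
...   | tri< r̂<r̂' _ _ = ⊥-elim (between-nonempty m r̂' r̂<r̂' (target<source m') (target-empty m'))
...   | tri> _ _ r̂'<r̂ = ⊥-elim (between-nonempty m' r̂ r̂'<r̂ (target<source m) (target-empty m))
...   | tri≈ _ refl _ = refl , refl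

applied : (ℕ → ℕ → Cell) → (r c r̂ : ℕ) → ℕ → ℕ → Cell
applied cells r c r̂ p q with site r c r̂ p q
... | at-source _ _ = ghost
... | at-target _ _ = ordinary
... | elsewhere _ _ = cells p q

result≗applied : ∀ {D r c r̂ E} → MoveResult D r c r̂ E → ∀ p q → cell E p q ≡ applied (cell D) r c r̂ p q
result≗applied {r = r} {c} {r̂} (gh , ord , rest) p q with site r c r̂ p q
... | at-source refl refl = gh
... | at-target refl refl = ord
... | elsewhere ≠src ≠tgt = rest p q ≠src ≠tgt

result-unique : ∀ {D r c r̂ E E'} → MoveResult D r c r̂ E → MoveResult D r c r̂ E' → E ≅ E'
result-unique {D} {r} {c} {r̂} {E} {E'} res res' =
  mk≅ λ p q → trans (result≗applied {D} {r} {c} {r̂} {E} res p q) (sym (result≗applied {D} {r} {c} {r̂} {E'} res' p q))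

move-deterministic : ∀ {D r c r̂ E c' r̂' E'} → Move D r c r̂ E → Move D r c' r̂' E' → E ≅ E'
move-deterministic {D} {r} {c} {r̂} {E} {E' = E'} m m' with move-position-unique m m'
... | refl , refl = result-unique {D} {r} {c} {r̂} {E} {E'} (result m) (result m')

infix  4 _↠_
infixr 5 _◅_

data _↠_ : Diagram → Diagram → Set where
  stop : ∀ {D E} → D ≅ E → D ↠ E
  _◅_  : ∀ {D r c r̂ D' E} → Move D r c r̂ D' → D' ↠ E → D ↠ E

↠-refl : ∀ {D} → D ↠ D
↠-refl = stop ≅-refl

↠-resp-source : ∀ {D D' E} → D ≅ D' → D ↠ E → D' ↠ E
↠-resp-source e (stop f)   = stop (≅-trans (≅-sym e) f)
↠-resp-source e (m ◅ rest) = Move-resp-≅ e m ◅ rest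

↠-resp-target : ∀ {D E E'} → E ≅ E' → D ↠ E → D ↠ E'
↠-resp-target e (stop f)   = stop (≅-trans f e)
↠-resp-target e (m ◅ rest) = m ◅ ↠-resp-target e rest

↠-trans : ∀ {D E F} → D ↠ E → E ↠ F → D ↠ F
↠-trans (stop e)   q = ↠-resp-source (≅-sym e) q
↠-trans (m ◅ rest) q = m ◅ ↠-trans rest q

Move⇒↠ : ∀ {D r c r̂ E} → Move D r c r̂ E → D ↠ E
Move⇒↠ m = m ◅ ↠-refl

-- A ghost move that does not apply is an identity step; _↠_ drops those.
⇝*⇒↠ : ∀ {D E} → D ⇝* E → D ↠ E
⇝*⇒↠ (done E≈D)                             = stop (≅-sym (mk≅ E≈D))
⇝*⇒↠ (step _ (inj₁ (_ , _ , a , res)) rest)   = mkMove a res ◅ ⇝*⇒↠ rest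
⇝*⇒↠ {D} (step {D' = D'} _ (inj₂ (_ , D'≈D)) rest) =
  ↠-resp-source (mk≅ {D'} {D} D'≈D) (⇝*⇒↠ rest)

↠⇒⇝* : ∀ {D E} → D ↠ E → D ⇝* E
↠⇒⇝* (stop D≅E)                        = done (pointwise (≅-sym D≅E))
↠⇒⇝* (_◅_ {r = r} {c} {r̂} m rest) = step r (inj₁ (c , r̂ , applicable m , result m)) (↠⇒⇝* rest)

record Invariant (P : Diagram → Set) : Set where
  field
    resp-≅ : ∀ {D E} → D ≅ E → P D → P E
    move   : ∀ {D r c r̂ E} → Move D r c r̂ E → P D → P E

  along : ∀ {D E} → D ↠ E → P D → P E
  along (stop e)   = resp-≅ e
  along (m ◅ rest) = along rest ∘ move m
open Invariant using (along)

Ghosts : Diagram → Rel ℕ 0ℓ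
Ghosts D p q = cell D p q ≡ ghost

ghost-persists : ∀ {D E} → D ↠ E → Ghosts D ⇒ Ghosts E
ghost-persists D↠E {p} {q} = along record
  { resp-≅ = λ e → trans (sym (pointwise e p q))
  ; move   = ghost-persists-move
  } D↠E

Stuck : Rel ℕ 0ℓ → Diagram → Set
Stuck S D = ∀ {r c r̂ E} → Move D r c r̂ E → ¬ S r c

stuck⇒↠-trivial : ∀ {S D E} → Stuck S D → D ↠ E → Ghosts E ⇒ S → E ≅ D
stuck⇒↠-trivial _     (stop D≅E) _      = ≅-sym D≅E
stuck⇒↠-trivial stuck (m ◅ rest) within = ⊥-elim (stuck m (within (ghost-persists rest (source-ghost m))))

Boxed : ℕ → Diagram → Set
Boxed B D = ∀ p q → B ≤ p ⊎ B ≤ q → cell D p q ≡ empty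

inside-box : ∀ {B p q} → p < B → q < B → ¬ (B ≤ p ⊎ B ≤ q)
inside-box p<B _   (inj₁ B≤p) = <⇒≱ p<B B≤p
inside-box _   q<B (inj₂ B≤q) = <⇒≱ q<B B≤q

nonempty⇒inside-box : ∀ {B D p q} → Boxed B D → cell D p q ≢ empty → p < B × q < B
nonempty⇒inside-box {B} {p = p} {q} boxed ne with B ≤? p | B ≤? q
... | yes B≤p | _       = ⊥-elim (ne (boxed p q (inj₁ B≤p)))
... | no _    | yes B≤q = ⊥-elim (ne (boxed p q (inj₂ B≤q)))
... | no B≰p  | no B≰q  = ≰⇒> B≰p , ≰⇒> B≰q

source-inside-box : ∀ {B D r c r̂ E} → Boxed B D → Move D r c r̂ E → r < B × c < B
source-inside-box {D = D} boxed m = nonempty⇒inside-box {D = D} boxed (ordinary⇒nonempty (source-ordinary m))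

applied-boxed : ∀ {B D r c r̂} → Boxed B D → r̂ < r → r < B × c < B →
                ∀ p q → B ≤ p ⊎ B ≤ q → applied (cell D) r c r̂ p q ≡ empty
applied-boxed {r = r} {c} {r̂} boxed r̂<r (r<B , c<B) p q out with site r c r̂ p q
... | at-source refl refl = ⊥-elim (inside-box r<B c<B out)
... | at-target refl refl = ⊥-elim (inside-box (<-trans r̂<r r<B) c<B out)
... | elsewhere _ _       = boxed p q out

Boxed-invariant : ∀ B → Invariant (Boxed B)
Boxed-invariant B = record
  { resp-≅ = λ e boxed p q out → trans (sym (pointwise e p q)) (boxed p q out)
  ; move   = λ {D} {r} {c} {r̂} {E} m boxed p q out →
      trans (result≗applied {D} {r} {c} {r̂} {E} (result m) p q)
            (applied-boxed {D = D} boxed (target<source m) (source-inside-box boxed m) p q out)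
  }

sum< : ℕ → (ℕ → ℕ) → ℕ
sum< zero    f = 0
sum< (suc n) f = sum< n f + f n

sum<-mono-≤ : ∀ n {f g} → (∀ i → i < n → f i ≤ g i) → sum< n f ≤ sum< n g
sum<-mono-≤ zero    _   = z≤n
sum<-mono-≤ (suc n) f≤g = +-mono-≤ (sum<-mono-≤ n (λ i i<n → f≤g i (m<n⇒m<1+n i<n))) (f≤g n (n<1+n n))

sum<-mono-< : ∀ n {f g k} → (∀ i → i < n → f i ≤ g i) → k < n → f k < g k → sum< n f < sum< n g
sum<-mono-< (suc n) {k = k} f≤g k<1+n fk<gk with k ≟ n
... | yes refl = +-mono-≤-< (sum<-mono-≤ n (λ i i<n → f≤g i (m<n⇒m<1+n i<n))) fk<gk
... | no k≢n   = +-mono-<-≤ (sum<-mono-< n (λ i i<n → f≤g i (m<n⇒m<1+n i<n)) (≤∧≢⇒< (≤-pred k<1+n) k≢n) fk<gk)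
                            (f≤g n (n<1+n n))

isEmpty : Cell → ℕ
isEmpty empty = 1
isEmpty _     = 0

isEmpty-anti : ∀ a b → (a ≢ empty → b ≢ empty) → isEmpty b ≤ isEmpty a
isEmpty-anti _        ordinary _  = z≤n
isEmpty-anti _        ghost    _  = z≤n
isEmpty-anti empty    empty    _  = ≤-refl
isEmpty-anti ordinary empty    ne = ⊥-elim (ne (λ ()) refl)
isEmpty-anti ghost    empty    ne = ⊥-elim (ne (λ ()) refl)

emptyCount : ℕ → Diagram → ℕ
emptyCount B D = sum< B λ p → sum< B λ q → isEmpty (cell D p q)

emptyCount-decreases : ∀ {B D r c r̂ E} → Boxed B D → Move D r c r̂ E → emptyCount B E < emptyCount B D
emptyCount-decreases {B} {D} {r} {c} {r̂} {E} boxed m =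
  sum<-mono-< B (λ p _ → sum<-mono-≤ B (λ q _ → fewer p q)) r̂<B
    (sum<-mono-< B (λ q _ → fewer r̂ q) c<B target-filled)
  where
  r<B = proj₁ (source-inside-box boxed m)
  c<B = proj₂ (source-inside-box boxed m)
  r̂<B = <-trans (target<source m) r<B
  fewer : ∀ p q → isEmpty (cell E p q) ≤ isEmpty (cell D p q)
  fewer p q = isEmpty-anti (cell D p q) (cell E p q) (nonempty-persists-move m)
  target-filled : isEmpty (cell E r̂ c) < isEmpty (cell D r̂ c)
  target-filled rewrite target-ordinary m | target-empty m = s≤s z≤n

move-exists : ∀ {D r c r̂} → Applicable D r c r̂ → ∃ (Move D r c r̂)
move-exists {D} {r} {c} {r̂} a = E , mkMove a (applied-source , applied-target , applied-elsewhere)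
  where
  r̂<r = proj₁ (proj₂ (proj₂ a))
  E : Diagram
  E = record
    { cell   = applied (cell D) r c r̂
    ; bound  = bound D
    ; finite = applied-boxed {D = D} (finite D) r̂<r
                 (nonempty⇒inside-box {D = D} (finite D) (ordinary⇒nonempty (proj₁ a)))
    }
  applied-source : applied (cell D) r c r̂ r c ≡ ghost
  applied-source with site r c r̂ r c
  ... | at-source _ _     = refl
  ... | at-target r≡r̂ _   = ⊥-elim (<-irrefl (sym r≡r̂) r̂<r)
  ... | elsewhere ≠src _ = ⊥-elim (≠src (refl , refl))
  applied-target : applied (cell D) r c r̂ r̂ c ≡ ordinary
  applied-target with site r c r̂ r̂ c
  ... | at-source r̂≡r _   = ⊥-elim (<-irrefl r̂≡r r̂<r)
  ... | at-target _ _     = refl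
  ... | elsewhere _ ≠tgt = ⊥-elim (≠tgt (refl , refl))
  applied-elsewhere : ∀ p q → ¬ (p ≡ r × q ≡ c) → ¬ (p ≡ r̂ × q ≡ c) → applied (cell D) r c r̂ p q ≡ cell D p q
  applied-elsewhere p q ≠src ≠tgt with site r c r̂ p q
  ... | at-source p≡r q≡c = ⊥-elim (≠src (p≡r , q≡c))
  ... | at-target p≡r̂ q≡c = ⊥-elim (≠tgt (p≡r̂ , q≡c))
  ... | elsewhere _ _     = refl

between? : ∀ {P : ℕ → Set} → (∀ k → Dec (P k)) → ∀ l u → Dec (∀ k → l < k → k < u → P k)
between? P? l u = map′ (λ h k l<k k<u → h k<u l<k) (λ h {k} k<u l<k → h k l<k k<u)
                       (allUpTo? (λ k → l <? k →-dec P? k) u)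

right-of-empty? : ∀ D r c → Dec (∀ c' → c < c' → cell D r c' ≡ empty)
right-of-empty? D r c = map′ beyond-bound (λ h c' c<c' _ → h c' c<c')
                             (between? (λ c' → cell D r c' ≟ᶜ empty) c (bound D))
  where
  beyond-bound : (∀ c' → c < c' → c' < bound D → cell D r c' ≡ empty) → ∀ c' → c < c' → cell D r c' ≡ empty
  beyond-bound h c' c<c' with c' <? bound D
  ... | yes c'<B = h c' c<c' c'<B
  ... | no  c'≮B = finite D r c' (inj₂ (≮⇒≥ c'≮B))

applicable? : ∀ D r c r̂ → Dec (Applicable D r c r̂)
applicable? D r c r̂ =
  cell D r c ≟ᶜ ordinary ×-dec right-of-empty? D r c ×-dec r̂ <? r ×-dec cell D r̂ c ≟ᶜ empty ×-dec
  between? (λ r' → ¬? (cell D r' c ≟ᶜ empty)) r̂ r ×-dec between? (λ r' → ¬? (cell D r' c ≟ᶜ ghost)) r̂ r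

S-move-or-stuck : ∀ {S B D} → Decidable S → Boxed B D →
                  (∃[ r ] ∃[ c ] ∃[ r̂ ] S r c × ∃ (Move D r c r̂)) ⊎ Stuck S D
S-move-or-stuck {S} {B} {D} S? boxed
  with anyUpTo? (λ r → anyUpTo? (λ c → anyUpTo? (λ r̂ → applicable? D r c r̂ ×-dec S? r c) r) B) B
... | yes (r , _ , c , _ , r̂ , _ , a , s) = inj₁ (r , c , r̂ , s , move-exists a)
... | no none = inj₂ stuck
  where
  stuck : Stuck S D
  stuck {r} {c} {r̂} m s with source-inside-box {D = D} boxed m
  ... | r<B , c<B = none (r , r<B , c , c<B , r̂ , target<source m , applicable m , s)

saturate : ∀ {S B} → Decidable S → ∀ D → Boxed B D → ∃ λ J → D ↠ J × Ghosts J ⇒ (Ghosts D ∪ S) × Stuck S J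
saturate {S} {B} S? D boxed = go D boxed (<-wellFounded (emptyCount B D))
  where
  go : ∀ D → Boxed B D → Acc _<_ (emptyCount B D) → ∃ λ J → D ↠ J × Ghosts J ⇒ (Ghosts D ∪ S) × Stuck S J
  go D boxed (acc smaller) with S-move-or-stuck {D = D} S? boxed
  ... | inj₂ stuck = D , ↠-refl , inj₁ , stuck
  ... | inj₁ (r , c , r̂ , s , E , m)
    with go E (Invariant.move (Boxed-invariant B) m boxed) (smaller (emptyCount-decreases {D = D} boxed m))
  ...   | J , E↠J , within , stuck = J , m ◅ E↠J , within′ , stuck
    where
    within′ : Ghosts J ⇒ (Ghosts D ∪ S)
    within′ g with within g
    ... | inj₂ s′ = inj₂ s′
    ... | inj₁ gE with new-ghost-at-source m gE
    ...   | inj₁ gD            = inj₁ gD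
    ...   | inj₂ (refl , refl) = inj₂ s

MovesCommute : Diagram → Set
MovesCommute x = ∀ {a ca ra xa b cb rb xb} → Move x a ca ra xa → Move x b cb rb xb → a ≢ b →
                 ∃ λ y → Move xa b cb rb y × Move xb a ca ra y

target≢source : ∀ {x a ca ra xa b cb rb xb} → Move x a ca ra xa → Move x b cb rb xb → ¬ (rb ≡ a × cb ≡ ca)
target≢source A B (refl , refl) = ordinary⇒nonempty (source-ordinary A) (target-empty B)

results-commute : ∀ {x a ca ra xa b cb rb xb y} → Move x a ca ra xa → Move x b cb rb xb → Move xb a ca ra y →
                  ¬ (b ≡ a × cb ≡ ca) → ¬ (b ≡ ra × cb ≡ ca) → ¬ (rb ≡ a × cb ≡ ca) → ¬ (rb ≡ ra × cb ≡ ca) →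
                  MoveResult xa b cb rb y
results-commute {a = a} {ca} {ra} {xa} {b} {cb} {rb} {y = y} A B Y srcB≠srcA srcB≠tgtA tgtB≠srcA tgtB≠tgtA =
  trans (unchanged Y srcB≠srcA srcB≠tgtA) (source-ghost B) ,
  trans (unchanged Y tgtB≠srcA tgtB≠tgtA) (target-ordinary B) ,
  elsewhere′
  where
  elsewhere′ : ∀ p q → ¬ (p ≡ b × q ≡ cb) → ¬ (p ≡ rb × q ≡ cb) → cell y p q ≡ cell xa p q
  elsewhere′ p q ≠srcB ≠tgtB with site a ca ra p q
  ... | at-source refl refl = trans (source-ghost Y) (sym (source-ghost A))
  ... | at-target refl refl = trans (target-ordinary Y) (sym (target-ordinary A))
  ... | elsewhere ≠srcA ≠tgtA =
    trans (unchanged Y ≠srcA ≠tgtA) (trans (unchanged B ≠srcB ≠tgtB) (sym (unchanged A ≠srcA ≠tgtA)))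

module Compatible {x a ca ra xa b cb rb xb} (A : Move x a ca ra xa) (B : Move x b cb rb xb) (a<b : a < b)
                  (no-jump : ¬ (ca ≡ cb × rb < a)) (no-landing-right : ¬ (rb ≡ a × ca < cb)) where

  ra<b : ra < b
  ra<b = <-trans (target<source A) a<b

  row-b-unchanged : ∀ q → cell xa b q ≡ cell x b q
  row-b-unchanged q = unchanged A (<⇒≢ a<b ∘ sym ∘ proj₁) (<⇒≢ ra<b ∘ sym ∘ proj₁)

  targets-differ : ¬ (rb ≡ ra × cb ≡ ca)
  targets-differ (refl , refl) = no-jump (refl , target<source A)

  lower-survives : Applicable xb a ca ra
  lower-survives =
    trans (unchanged B (<⇒≢ a<b ∘ proj₁) (λ (a≡rb , ca≡cb) → target≢source A B (sym a≡rb , sym ca≡cb)))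
          (source-ordinary A) ,
    (λ c' ca<c' → trans (unchanged B (<⇒≢ a<b ∘ proj₁)
                                      (λ (a≡rb , c'≡cb) → no-landing-right (sym a≡rb , subst (ca <_) c'≡cb ca<c')))
                        (right-of-source-empty A c' ca<c')) ,
    target<source A ,
    trans (unchanged B (<⇒≢ ra<b ∘ proj₁) (λ (ra≡rb , ca≡cb) → targets-differ (sym ra≡rb , sym ca≡cb)))
          (target-empty A) ,
    (λ r' ra<r' r'<a → nonempty-persists-move B (between-nonempty A r' ra<r' r'<a)) ,
    (λ r' ra<r' r'<a → [ between-not-ghost A r' ra<r' r'<a , (λ (r'≡b , _) → <⇒≢ (<-trans r'<a a<b) r'≡b) ]
                       ∘ new-ghost-at-source B)

  upper-survives : Applicable xa b cb rb
  upper-survives =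
    trans (row-b-unchanged cb) (source-ordinary B) ,
    (λ c' cb<c' → trans (row-b-unchanged c') (right-of-source-empty B c' cb<c')) ,
    target<source B ,
    trans (unchanged A (target≢source A B) targets-differ) (target-empty B) ,
    (λ r' rb<r' r'<b → nonempty-persists-move A (between-nonempty B r' rb<r' r'<b)) ,
    (λ r' rb<r' r'<b → [ between-not-ghost B r' rb<r' r'<b ,
                         (λ (r'≡a , cb≡ca) → no-jump (sym cb≡ca , subst (rb <_) r'≡a rb<r')) ]
                       ∘ new-ghost-at-source A)

  compatible-moves-commute : ∃ λ y → Move xa b cb rb y × Move xb a ca ra y
  compatible-moves-commute with move-exists {xb} {a} {ca} {ra} lower-survives
  ... | y , Y = y , mkMove upper-survives (results-commute A B Y (<⇒≢ a<b ∘ sym ∘ proj₁) (<⇒≢ ra<b ∘ sym ∘ proj₁)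
                                                             (target≢source A B) targets-differ) , Y

PinnedAboveGhost : (a b c : ℕ) → Diagram → Set
PinnedAboveGhost a b c z =
  cell z b c ≡ ordinary × cell z a c ≡ ghost × (∀ r' → a < r' → r' < b → cell z r' c ≢ empty)

pinned-immobile : ∀ {a b c z r̂ E} → a < b → PinnedAboveGhost a b c z → ¬ Move z b c r̂ E
pinned-immobile {a} {r̂ = r̂} a<b (_ , gh , filled) m with <-cmp r̂ a
... | tri< r̂<a _ _ = between-not-ghost m a r̂<a a<b gh
... | tri≈ _ refl _ = ghost⇒nonempty gh (target-empty m)
... | tri> _ _ a<r̂ = filled r̂ a<r̂ (target<source m) (target-empty m)

PinnedAboveGhost-invariant : ∀ {a b c} → a < b → Invariant (PinnedAboveGhost a b c)
PinnedAboveGhost-invariant {a} {b} {c} a<b = record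
  { resp-≅ = λ e (ord , gh , filled) →
      trans (sym (pointwise e b c)) ord , trans (sym (pointwise e a c)) gh ,
      λ r' l u → filled r' l u ∘ trans (pointwise e r' c)
  ; move   = λ m pinned@(ord , gh , filled) →
      ordinary-persists-move m ord (λ { (refl , refl) → pinned-immobile a<b pinned m }) ,
      ghost-persists-move m gh ,
      λ r' l u → nonempty-persists-move m (filled r' l u)
  }

BlockedOnRight : (a ca cb : ℕ) → Diagram → Set
BlockedOnRight a ca cb z = cell z a ca ≡ ordinary × cell z a cb ≢ empty

BlockedOnRight-invariant : ∀ {a ca cb} → ca < cb → Invariant (BlockedOnRight a ca cb)
BlockedOnRight-invariant {a} {ca} {cb} ca<cb = record
  { resp-≅ = λ e (ord , ne) → trans (sym (pointwise e a ca)) ord , ne ∘ trans (pointwise e a cb)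
  ; move   = λ m (ord , ne) →
      ordinary-persists-move m ord (λ { (refl , refl) → ne (right-of-source-empty m cb ca<cb) }) ,
      nonempty-persists-move m ne
  }

module UniqueMinimum (D m₀ : Diagram) (reaches-m₀ : ∀ {x} → D ↠ x → x ↠ m₀) where

  frozen-cell-not-ghost : ∀ {P p q x y} → Invariant P → (∀ {z} → P z → cell z p q ≡ ordinary) →
                          D ↠ x → P x → D ↠ y → cell y p q ≢ ghost
  frozen-cell-not-ghost inv ordinary-of D↠x Px D↠y gh =
    ordinary⇒not-ghost (ordinary-of (along inv (reaches-m₀ D↠x) Px)) (ghost-persists (reaches-m₀ D↠y) gh)

  no-jump : ∀ {x a c ra xa b rb xb} → D ↠ x → Move x a c ra xa → Move x b c rb xb → a < b → ¬ rb < a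
  no-jump D↠x A B a<b rb<a =
    frozen-cell-not-ghost (PinnedAboveGhost-invariant a<b) proj₁ (↠-trans D↠x (Move⇒↠ A)) pinned
                          (↠-trans D↠x (Move⇒↠ B)) (source-ghost B)
    where
    pinned =
      trans (unchanged A (<⇒≢ a<b ∘ sym ∘ proj₁) (<⇒≢ (<-trans (target<source A) a<b) ∘ sym ∘ proj₁))
            (source-ordinary B) ,
      source-ghost A ,
      λ r' a<r' r'<b → nonempty-persists-move A (between-nonempty B r' (<-trans rb<a a<r') r'<b)

  no-landing-right : ∀ {x a ca ra xa b cb xb} → D ↠ x → Move x a ca ra xa → Move x b cb a xb → ¬ ca < cb
  no-landing-right D↠x A B ca<cb =
    frozen-cell-not-ghost (BlockedOnRight-invariant ca<cb) proj₁ (↠-trans D↠x (Move⇒↠ B)) blocked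
                          (↠-trans D↠x (Move⇒↠ A)) (source-ghost A)
    where
    blocked =
      trans (unchanged B (<⇒≢ (target<source B) ∘ proj₁) (<⇒≢ ca<cb ∘ proj₂)) (source-ordinary A) ,
      ordinary⇒nonempty (target-ordinary B)

  ordered-moves-commute : ∀ {x a ca ra xa b cb rb xb} → D ↠ x → Move x a ca ra xa → Move x b cb rb xb → a < b →
                        ∃ λ y → Move xa b cb rb y × Move xb a ca ra y
  ordered-moves-commute {a = a} {ca} {b = b} {cb} {rb} D↠x A B a<b
    with (ca ≟ cb) ×-dec (rb <? a) | (rb ≟ a) ×-dec (ca <? cb)
  ... | yes (refl , rb<a) | _                 = ⊥-elim (no-jump D↠x A B a<b rb<a)
  ... | no _              | yes (refl , ca<cb) = ⊥-elim (no-landing-right D↠x A B ca<cb)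
  ... | no jump           | no landing-right  = Compatible.compatible-moves-commute A B a<b jump landing-right

  moves-commute : ∀ {x} → D ↠ x → MovesCommute x
  moves-commute D↠x {a = a} {b = b} A B a≢b with <-cmp a b
  ... | tri< a<b _ _ = ordered-moves-commute D↠x A B a<b
  ... | tri≈ _ a≡b _ = ⊥-elim (a≢b a≡b)
  ... | tri> _ _ b<a = map₂ swap (ordered-moves-commute D↠x B A b<a)

module Confluence (D : Diagram) (commute : ∀ {x} → D ↠ x → MovesCommute x) where

  replay : ∀ {x r c r̂ x₁ w} → D ↠ x → Move x r c r̂ x₁ → x ↠ w →
           x₁ ↠ w ⊎ ∃ λ w₁ → Move w r c r̂ w₁ × x₁ ↠ w₁
  replay _ m (stop x≅w) = inj₂ (_ , Move-resp-≅ x≅w m , ↠-refl)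
  replay {r = r} D↠x m (_◅_ {r = s} m′ rest) with s ≟ r
  ... | yes refl = inj₁ (↠-resp-source (move-deterministic m′ m) rest)
  ... | no s≢r with commute D↠x m m′ (s≢r ∘ sym)
  ...   | y , m′-after-m , m-after-m′ with replay (↠-trans D↠x (Move⇒↠ m′)) m-after-m′ rest
  ...     | inj₁ y↠w                 = inj₁ (m′-after-m ◅ y↠w)
  ...     | inj₂ (w₁ , m-at-w , y↠w₁) = inj₂ (w₁ , m-at-w , m′-after-m ◅ y↠w₁)

  common-lower-bound : ∀ {x y w} → D ↠ x → x ↠ y → x ↠ w →
                       ∃ λ l → y ↠ l × w ↠ l × Ghosts l ⇒ (Ghosts y ∪ Ghosts w)
  common-lower-bound _ (stop x≅y) x↠w = _ , ↠-resp-source x≅y x↠w , ↠-refl , inj₂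
  common-lower-bound {y = y} {w} D↠x (m ◅ rest) x↠w with replay D↠x m x↠w
  ... | inj₁ x₁↠w = common-lower-bound (↠-trans D↠x (Move⇒↠ m)) rest x₁↠w
  ... | inj₂ (w₁ , m-at-w , x₁↠w₁) with common-lower-bound (↠-trans D↠x (Move⇒↠ m)) rest x₁↠w₁
  ...   | l , y↠l , w₁↠l , within = l , y↠l , m-at-w ◅ w₁↠l , within′
    where
    within′ : Ghosts l ⇒ (Ghosts y ∪ Ghosts w)
    within′ g with within g
    ... | inj₁ gy  = inj₁ gy
    ... | inj₂ gw₁ with new-ghost-at-source m-at-w gw₁
    ...   | inj₁ gw            = inj₂ gw
    ...   | inj₂ (refl , refl) = inj₁ (ghost-persists rest (source-ghost m))

  ghosts-⊆⇒↠ : ∀ {x y w} → D ↠ x → x ↠ y → x ↠ w → Ghosts y ⇒ Ghosts w → y ↠ w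
  ghosts-⊆⇒↠ _ (stop x≅y) x↠w _ = ↠-resp-source x≅y x↠w
  ghosts-⊆⇒↠ D↠x (m ◅ rest) x↠w ⊆ with replay D↠x m x↠w
  ... | inj₁ x₁↠w          = ghosts-⊆⇒↠ (↠-trans D↠x (Move⇒↠ m)) rest x₁↠w ⊆
  ... | inj₂ (_ , m-at-w , _) =
    ⊥-elim (ordinary⇒not-ghost (source-ordinary m-at-w) (⊆ (ghost-persists rest (source-ghost m))))

module LatticeOperations (D : Diagram) (noGhosts : NoGhosts D) (commute : ∀ {x} → D ↠ x → MovesCommute x) where
  open Confluence D commute
  open GhostKohnertPoset D

  meet : ∀ x y → ∃[ z ] IsMeet x y z
  meet (X , D⇝X) (Y , D⇝Y) with common-lower-bound ↠-refl (⇝*⇒↠ D⇝X) (⇝*⇒↠ D⇝Y)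
  ... | M , X↠M , Y↠M , within = (M , ↠⇒⇝* D↠M) , ↠⇒⇝* X↠M , ↠⇒⇝* Y↠M , greatest
    where
    D↠M = ↠-trans (⇝*⇒↠ D⇝X) X↠M
    greatest : ∀ w → w ≼ (X , D⇝X) → w ≼ (Y , D⇝Y) → w ≼ (M , ↠⇒⇝* D↠M)
    greatest (W , D⇝W) X⇝W Y⇝W = ↠⇒⇝* (ghosts-⊆⇒↠ ↠-refl D↠M (⇝*⇒↠ D⇝W)
      λ g → [ ghost-persists (⇝*⇒↠ X⇝W) , ghost-persists (⇝*⇒↠ Y⇝W) ] (within g))

  join : ∀ x y → ∃[ z ] IsJoin x y z
  join (X , D⇝X) (Y , D⇝Y)
    with saturate (decidable (λ p q → cell X p q ≟ᶜ ghost) (λ p q → cell Y p q ≟ᶜ ghost)) D (finite D)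
  ... | J , D↠J , within , stuck =
    (J , ↠⇒⇝* D↠J) , J-reaches D⇝X (λ g → proj₁ (shared g)) , J-reaches D⇝Y (λ g → proj₂ (shared g)) , least
    where
    shared : Ghosts J ⇒ (Ghosts X ∩ Ghosts Y)
    shared g = [ (λ gD → ⊥-elim (noGhosts _ _ gD)) , (λ s → s) ] (within g)
    J-reaches : ∀ {Z} → D ⇝* Z → Ghosts J ⇒ Ghosts Z → J ⇝* Z
    J-reaches D⇝Z ⊆ = ↠⇒⇝* (ghosts-⊆⇒↠ ↠-refl D↠J (⇝*⇒↠ D⇝Z) ⊆)
    least : ∀ w → (X , D⇝X) ≼ w → (Y , D⇝Y) ≼ w → (J , ↠⇒⇝* D↠J) ≼ w
    least (W , D⇝W) W⇝X W⇝Y with common-lower-bound ↠-refl D↠J (⇝*⇒↠ D⇝W)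
    ... | L , J↠L , W↠L , L-within = ↠⇒⇝* (↠-resp-target (stuck⇒↠-trivial stuck J↠L L-shared) W↠L)
      where
      L-shared : Ghosts L ⇒ (Ghosts X ∩ Ghosts Y)
      L-shared g = [ shared , (λ gW → ghost-persists (⇝*⇒↠ W⇝X) gW , ghost-persists (⇝*⇒↠ W⇝Y) gW) ] (L-within g)

module Bounds (D : Diagram) (noGhosts : NoGhosts D) where
  open GhostKohnertPoset D

  stuck⇒minimal : ∀ {J} (D↠J : D ↠ J) → Stuck Always J → Minimal (J , ↠⇒⇝* D↠J)
  stuck⇒minimal _ stuck (X , _) J⇝X = pointwise (stuck⇒↠-trivial stuck (⇝*⇒↠ J⇝X) _)

  minimal-below : ∀ {x} → D ↠ x → Σ (GKD D) λ m → Minimal m × x ↠ proj₁ m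
  minimal-below D↠x with saturate {S = Always} (λ _ _ → yes _) _ (along (Boxed-invariant (bound D)) D↠x (finite D))
  ... | J , x↠J , _ , stuck = (J , ↠⇒⇝* (↠-trans D↠x x↠J)) , stuck⇒minimal (↠-trans D↠x x↠J) stuck , x↠J

  top : GKD D
  top = D , ↠⇒⇝* ↠-refl

  top-maximal : Maximal top
  top-maximal (X , _) X⇝D =
    pointwise (≅-sym (stuck⇒↠-trivial {S = Never} (λ { _ (lift ()) }) (⇝*⇒↠ X⇝D) (λ g → ⊥-elim (noGhosts _ _ g))))

  top-unique : ∀ M → Maximal M → M ≐ top
  top-unique (M , D⇝M) M-maximal = pointwise (≅-sym (mk≅ {D} {M} (M-maximal top D⇝M)))

  lattice⇒bounded : IsLattice → IsBounded
  lattice⇒bounded lattice with minimal-below ↠-refl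
  ... | m , m-minimal , _ = (m , m-minimal , minimum-unique) , (top , top-maximal , top-unique)
    where
    minimum-unique : ∀ m' → Minimal m' → m' ≐ m
    minimum-unique m' m'-minimal with proj₂ (lattice m m')
    ... | z , z≼m , z≼m' , _ =
      pointwise (≅-trans (≅-sym (mk≅ {proj₁ z} {proj₁ m'} (m'-minimal z z≼m'))) (mk≅ {proj₁ z} {proj₁ m} (m-minimal z z≼m)))

  bounded⇒lattice : IsBounded → IsLattice
  bounded⇒lattice ((m₀ , _ , minimum-unique) , _) x y = join x y , meet x y
    where
    reaches-m₀ : ∀ {x} → D ↠ x → x ↠ proj₁ m₀
    reaches-m₀ D↠x with minimal-below D↠x
    ... | m , m-minimal , x↠m = ↠-resp-target (mk≅ (minimum-unique m m-minimal)) x↠m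
    open LatticeOperations D noGhosts (UniqueMinimum.moves-commute D (proj₁ m₀) reaches-m₀)

theorem3p11 : (D : Diagram) → NoGhosts D →
    (GhostKohnertPoset.IsLattice D ⇔ GhostKohnertPoset.IsBounded D)
theorem3p11 D noGhosts = mk⇔ lattice⇒bounded bounded⇒lattice
  where open Bounds D noGhosts
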